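{- Let $r\ge 1$ be an integer, let $G$ be a $k$-graph and let $F$ be a subgraph of $G$ with $\nu(F)<r$. Let $t=(r-1)k$ and let $S\subseteq V(G)$ be such that $S$ is $t$-heavy in $F$. Let $F'$ be the $k$-graph obtained from $F$ by adding all edges of $G$ containing $S$. Then $\nu(F')<r$.
   Context: $\nu(H)$ denotes the matching number of a hypergraph $H$ (the maximum number of pairwise disjoint edges). For $S\subseteq V(G)$, the link $L_G(S)$ is the $(k-|S|)$-graph on $V(G)$ with edge set $\{e\setminus S: e\in E(G),\ S\subseteq e\}$. For an integer $t$, $S$ is $t$-heavy in $G$ if $\nu(L_G(S))>t$, and $t$-light otherwise. -}

module Defs where

open import Data.Nat using (ℕ; suc)
open import Data.Fin using (Fin)
open import Data.Fin.Subset using (Subset; _∈_; _⊆_; _─_; ∣_∣)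
open import Data.Product using (Σ; ∃; _×_)
open import Data.Sum using (_⊎_)
open import Data.Empty using (⊥)
open import Relation.Nullary using (¬_)
open import Relation.Binary.PropositionalEquality using (_≡_; _≢_)

Hypergraph : ℕ → Set₁
Hypergraph n = Subset n → Set

IsKGraph : ∀ {n} → ℕ → Hypergraph n → Set
IsKGraph k H = ∀ e → H e → ∣ e ∣ ≡ k

SubgraphOf : ∀ {n} → Hypergraph n → Hypergraph n → Set
SubgraphOf F G = ∀ e → F e → G e

Disjoint : ∀ {n} → Subset n → Subset n → Set
Disjoint e f = ∀ x → x ∈ e → x ∈ f → ⊥

Matching : ∀ {n} → Hypergraph n → ℕ → Set
Matching {n} H m =
  Σ (Fin m → Subset n) λ M →
    (∀ i → H (M i)) ×
    (∀ i j → i ≢ j → (M i ≢ M j) × Disjoint (M i) (M j))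

νGreater : ∀ {n} → Hypergraph n → ℕ → Set
νGreater H t = Matching H (suc t)

νLess : ∀ {n} → Hypergraph n → ℕ → Set
νLess H r = ¬ Matching H r

Link : ∀ {n} → Hypergraph n → Subset n → Hypergraph n
Link H S f = ∃ λ e → H e × S ⊆ e × f ≡ e ─ S

Heavy : ∀ {n} → ℕ → Hypergraph n → Subset n → Set
Heavy t H S = νGreater (Link H S) t

AddEdgesContaining : ∀ {n} → Hypergraph n → Subset n → Hypergraph n → Hypergraph n
AddEdgesContaining G S F e = F e ⊎ (G e × S ⊆ e)

{-# OPTIONS --safe #-}
-- Given a matching of size r in F′, replace its edges one at a time by edges of F. An edge
-- M a outside F contains S, and the other r − 1 edges cover at most (r − 1)k vertices. The
-- link of S in F has (r − 1)k + 1 pairwise disjoint sets e ∖ S, so one of them misses all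
-- those vertices, while e ∩ S ⊆ M a misses them too; hence e can take the place of M a.
-- Once every edge has been replaced, F has a matching of size r.
module Submission where

open import Defs
open import Data.Nat using (ℕ; suc; _+_; _*_; _≤_; _∸_; z≤n; s≤s)
open import Data.Nat.Properties using (≤-trans; ≤-reflexive; +-mono-≤; +-monoʳ-≤; +-suc; n≤1+n)
open import Data.Fin using (Fin; zero; suc; punchIn; punchOut; _≟_)
open import Data.Fin.Properties using (any?; punchIn-injective; punchInᵢ≢i; punchIn-punchOut)
open import Data.Fin.Subset using (Subset; _∈_; _∉_; _⊆_; _─_; _∪_; ∣_∣; ⋃; ⊥; inside; outside)
open import Data.Fin.Subset.Properties using (_∈?_; x∈p∧x∉q⇒x∈p─q; Empty-unique; p⊆p∪q; q⊆p∪q; ∣⊥∣≡0)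
open import Data.Vec using ([]; _∷_; tail; there)
open import Data.Vec.Functional using (Vector; updateAt)
open import Data.Vec.Functional.Properties using (updateAt-updates; updateAt-minimal)
open import Data.List using (List; []; _∷_; tabulate; length; allFin)
open import Data.List.Properties using (length-tabulate)
open import Data.List.Relation.Unary.All using (All; []; _∷_)
open import Data.List.Relation.Unary.All.Properties using (tabulate⁺)
open import Data.List.Relation.Unary.Any as Any using (here; there)
open import Data.List.Membership.Propositional using () renaming (_∈_ to _∈ₗ_)
open import Data.List.Membership.Propositional.Properties using (∈-tabulate⁺; ∈-allFin)
open import Data.Product using (∃; _×_; _,_; proj₁; proj₂)
open import Data.Sum using (inj₁; inj₂; [_,_]′)
open import Level using (Level)
open import Function using (_∘_; const)
open import Function.Definitions using (Injective)
open import Relation.Binary using (Rel; Symmetric)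
open import Relation.Nullary using (yes; no; contradiction)
open import Relation.Binary.PropositionalEquality using (_≡_; _≢_; refl; sym; trans; cong; subst)

private
  variable
    ℓ : Level
    n m k t : ℕ
    A : Set
    p p′ q q′ s e : Subset n

Pairwise : Rel A ℓ → Vector A m → Set ℓ
Pairwise R f = ∀ i j → i ≢ j → R (f i) (f j)

Pairwise-∘ : {R : Rel A ℓ} {f : Vector A m} {g : Fin k → Fin m} →
             Injective _≡_ _≡_ g → Pairwise R f → Pairwise R (f ∘ g)
Pairwise-∘ g-inj f-pw i j i≢j = f-pw _ _ (i≢j ∘ g-inj)

updateAt-elim : (P : A → Set ℓ) (f : Vector A m) (i j : Fin m) {x : A} →
                (j ≡ i → P x) → (j ≢ i → P (f j)) → P (updateAt f i (const x) j)
updateAt-elim P f i j at-i off-i with j ≟ i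
... | yes refl = subst P (sym (updateAt-updates i f)) (at-i refl)
... | no j≢i   = subst P (sym (updateAt-minimal j i f j≢i)) (off-i j≢i)

Pairwise-updateAt : {R : Rel A ℓ} → Symmetric R → {f : Vector A m} → Pairwise R f →
                    ∀ {i x} → (∀ j → j ≢ i → R x (f j)) → Pairwise R (updateAt f i (const x))
Pairwise-updateAt {R = R} R-sym {f} f-pw {i} {x} x-R j j′ j≢j′ =
  updateAt-elim (λ y → R y _) f i j
    (λ { refl → updateAt-elim (R x) f i j′ (λ { refl → contradiction refl j≢j′ }) (x-R j′) })
    (λ j≢i → updateAt-elim (R (f j)) f i j′ (λ { refl → R-sym (x-R j j≢i) }) (λ _ → f-pw j j′ j≢j′))

Apart : Subset n → Subset n → Set
Apart e f = e ≢ f × Disjoint e f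

Apart-sym : Symmetric (Apart {n})
Apart-sym (e≢f , e∩f=∅) = e≢f ∘ sym , λ x x∈f x∈e → e∩f=∅ x x∈e x∈f

IsMatching : Hypergraph n → Vector (Subset n) m → Set
IsMatching H M = (∀ i → H (M i)) × Pairwise Apart M

Disjoint-⊆ˡ : p ⊆ p′ → Disjoint p′ q → Disjoint p q
Disjoint-⊆ˡ p⊆p′ p′∩q=∅ x x∈p = p′∩q=∅ x (p⊆p′ x∈p)

Disjoint-⊆ʳ : q ⊆ q′ → Disjoint p q′ → Disjoint p q
Disjoint-⊆ʳ q⊆q′ p∩q′=∅ x x∈p x∈q = p∩q′=∅ x x∈p (q⊆q′ x∈q)

Disjoint-─ : Disjoint (p ─ s) q → Disjoint s q → Disjoint p q
Disjoint-─ {s = s} p─s∩q=∅ s∩q=∅ x x∈p x∈q with x ∈? s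
... | yes x∈s = s∩q=∅ x x∈s x∈q
... | no  x∉s = p─s∩q=∅ x (x∈p∧x∉q⇒x∈p─q x∈p x∉s) x∈q

Disjoint-tail : {p q : Subset (suc n)} → Disjoint p q → Disjoint (tail p) (tail q)
Disjoint-tail {p = _ ∷ _} {_ ∷ _} p∩q=∅ x x∈p x∈q = p∩q=∅ (suc x) (there x∈p) (there x∈q)

Pairwise-tail : {f : Vector (Subset (suc n)) m} → Pairwise Disjoint f → Pairwise Disjoint (tail ∘ f)
Pairwise-tail f-pw i j i≢j = Disjoint-tail (f-pw i j i≢j)

Disjoint-∷ : {p q : Subset (suc n)} → (zero ∈ p → zero ∉ q) → Disjoint (tail p) (tail q) → Disjoint p q
Disjoint-∷ {p = _ ∷ _} {_ ∷ _} 0∉p∩q _     zero    x∈p         x∈q         = 0∉p∩q x∈p x∈q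
Disjoint-∷ {p = _ ∷ _} {_ ∷ _} _     tp∩tq=∅ (suc x) (there x∈p) (there x∈q) = tp∩tq=∅ x x∈p x∈q

∣p∪q∣≤∣p∣+∣q∣ : (p q : Subset n) → ∣ p ∪ q ∣ ≤ ∣ p ∣ + ∣ q ∣
∣p∪q∣≤∣p∣+∣q∣ []            []            = z≤n
∣p∪q∣≤∣p∣+∣q∣ (outside ∷ p) (outside ∷ q) = ∣p∪q∣≤∣p∣+∣q∣ p q
∣p∪q∣≤∣p∣+∣q∣ (inside  ∷ p) (outside ∷ q) = s≤s (∣p∪q∣≤∣p∣+∣q∣ p q)
∣p∪q∣≤∣p∣+∣q∣ (outside ∷ p) (inside  ∷ q) =
  ≤-trans (s≤s (∣p∪q∣≤∣p∣+∣q∣ p q)) (≤-reflexive (sym (+-suc ∣ p ∣ ∣ q ∣)))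
∣p∪q∣≤∣p∣+∣q∣ (inside  ∷ p) (inside  ∷ q) =
  s≤s (≤-trans (∣p∪q∣≤∣p∣+∣q∣ p q) (+-monoʳ-≤ ∣ p ∣ (n≤1+n ∣ q ∣)))

∣⋃∣≤length*k : {ps : List (Subset n)} → All (λ p → ∣ p ∣ ≤ k) ps → ∣ ⋃ ps ∣ ≤ length ps * k
∣⋃∣≤length*k {n} []                    = ≤-reflexive (∣⊥∣≡0 n)
∣⋃∣≤length*k {ps = p ∷ ps} (∣p∣≤k ∷ ∣ps∣≤k) =
  ≤-trans (∣p∪q∣≤∣p∣+∣q∣ p (⋃ ps)) (+-mono-≤ ∣p∣≤k (∣⋃∣≤length*k ∣ps∣≤k))

∈⇒⊆⋃ : {ps : List (Subset n)} → p ∈ₗ ps → p ⊆ ⋃ ps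
∈⇒⊆⋃ {ps = _ ∷ ps} (here refl)  = p⊆p∪q (⋃ ps)
∈⇒⊆⋃ {ps = q ∷ _}  (there p∈ps) = q⊆p∪q q _ ∘ ∈⇒⊆⋃ p∈ps

∣p∣≡0⇒p≡⊥ : (p : Subset n) → ∣ p ∣ ≡ 0 → p ≡ ⊥
∣p∣≡0⇒p≡⊥ []            _     = refl
∣p∣≡0⇒p≡⊥ (outside ∷ p) ∣p∣≡0 = cong (outside ∷_) (∣p∣≡0⇒p≡⊥ p ∣p∣≡0)

-- Only ∅ is disjoint from itself, and two distinct sets of equal size cannot both be ∅.
disjoint⇒≢ : ∣ p ∣ ≡ ∣ q ∣ → p ≢ q → Disjoint e q → e ≢ q
disjoint⇒≢ {n} {p} {q} ∣p∣≡∣q∣ p≢q q∩q=∅ refl = p≢q (trans p≡⊥ (sym q≡⊥))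
  where
  q≡⊥ : q ≡ ⊥
  q≡⊥ = Empty-unique λ (x , x∈q) → q∩q=∅ x x∈q x∈q
  p≡⊥ : p ≡ ⊥
  p≡⊥ = ∣p∣≡0⇒p≡⊥ p (trans ∣p∣≡∣q∣ (trans (cong ∣_∣ q≡⊥) (∣⊥∣≡0 n)))

at-most-one-member-∋ : (f : Fin (suc t) → Subset n) → Pairwise Disjoint f →
                       ∀ x → ∃ λ i₀ → ∀ i → i ≢ i₀ → x ∉ f i
at-most-one-member-∋ f f-pw x with any? (λ i → x ∈? f i)
... | yes (i₀ , x∈fi₀) = i₀ , λ i i≢i₀ x∈fi → f-pw i i₀ i≢i₀ x x∈fi x∈fi₀
... | no  x∉⋃f         = zero , λ i _ x∈fi → x∉⋃f (i , x∈fi)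

-- Induction on the ground set: the vertex 0 ∈ U lies in at most one f i₀, which is discarded.
disjoint-family-avoids : (f : Fin (suc t) → Subset n) → Pairwise Disjoint f →
                         (U : Subset n) → ∣ U ∣ ≤ t → ∃ λ i → Disjoint (f i) U
disjoint-family-avoids {n = 0} f _ [] _ = zero , λ ()
disjoint-family-avoids {n = suc n} f f-pw (outside ∷ U) ∣U∣≤t =
  let i , fi∩U=∅ = disjoint-family-avoids (tail ∘ f) (Pairwise-tail f-pw) U ∣U∣≤t
  in  i , Disjoint-∷ (λ _ ()) fi∩U=∅
disjoint-family-avoids {t = 0} {suc n} f f-pw (inside ∷ U) ()
disjoint-family-avoids {t = suc t} {suc n} f f-pw (inside ∷ U) (s≤s ∣U∣≤t) =
  let i₀ , 0∉others = at-most-one-member-∋ f f-pw zero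
      j , fj∩U=∅ = disjoint-family-avoids (tail ∘ f ∘ punchIn i₀)
                     (Pairwise-tail (Pairwise-∘ {R = Disjoint} (punchIn-injective i₀ _ _) f-pw)) U ∣U∣≤t
  in  punchIn i₀ j , Disjoint-∷ (λ 0∈fj _ → 0∉others (punchIn i₀ j) (punchInᵢ≢i i₀ j) 0∈fj) fj∩U=∅

heavy⇒avoiding-edge : {F : Hypergraph n} {S : Subset n} → Heavy t F S →
                      (U : Subset n) → ∣ U ∣ ≤ t → ∃ λ e → F e × Disjoint (e ─ S) U
heavy⇒avoiding-edge (L , L∈link , L-pw) U ∣U∣≤t =
  let i , Li∩U=∅ = disjoint-family-avoids L (λ i j i≢j → proj₂ (L-pw i j i≢j)) U ∣U∣≤t
      e , Fe , _ , Li≡e─S = L∈link i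
  in  e , Fe , subst (λ f → Disjoint f U) Li≡e─S Li∩U=∅

swap-edge-containing : {G F : Hypergraph n} {S : Subset n} {r′ : ℕ} →
                       IsKGraph k G → Heavy (r′ * k) F S →
                       {M : Vector (Subset n) (suc r′)} → IsMatching G M →
                       (a : Fin (suc r′)) → S ⊆ M a → ∃ λ e → F e × ∀ j → j ≢ a → Apart e (M j)
swap-edge-containing {k = k} {S = S} {r′} G-kgraph S-heavy {M} (M∈G , M-pw) a S⊆Ma =
  let e , Fe , e─S∩⋃others=∅ = heavy⇒avoiding-edge S-heavy (⋃ others) ∣⋃others∣≤r′k
  in  e , Fe , apart-from-others e─S∩⋃others=∅
  where
  ∣M∣≡k : ∀ i → ∣ M i ∣ ≡ k
  ∣M∣≡k i = G-kgraph (M i) (M∈G i)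

  others : List (Subset _)
  others = tabulate (M ∘ punchIn a)

  ∣⋃others∣≤r′k : ∣ ⋃ others ∣ ≤ r′ * k
  ∣⋃others∣≤r′k = subst (λ l → ∣ ⋃ others ∣ ≤ l * k) (length-tabulate (M ∘ punchIn a))
                    (∣⋃∣≤length*k (tabulate⁺ (≤-reflexive ∘ ∣M∣≡k ∘ punchIn a)))

  Mj⊆⋃others : ∀ j → j ≢ a → M j ⊆ ⋃ others
  Mj⊆⋃others j j≢a = ∈⇒⊆⋃ (subst (_∈ₗ others) (cong M (punchIn-punchOut a≢j)) (∈-tabulate⁺ (punchOut a≢j)))
    where a≢j = j≢a ∘ sym

  apart-from-others : ∀ {e} → Disjoint (e ─ S) (⋃ others) → ∀ j → j ≢ a → Apart e (M j)
  apart-from-others e─S∩⋃others=∅ j j≢a = disjoint⇒≢ (trans (∣M∣≡k a) (sym (∣M∣≡k j))) Ma≢Mj e∩Mj=∅ , e∩Mj=∅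
    where
    Ma≢Mj = proj₁ (M-pw a j (j≢a ∘ sym))
    e∩Mj=∅ = Disjoint-─ (Disjoint-⊆ʳ (Mj⊆⋃others j j≢a) e─S∩⋃others=∅)
                        (Disjoint-⊆ˡ S⊆Ma (proj₂ (M-pw a j (j≢a ∘ sym))))

swap-into-F : {G F : Hypergraph n} {S : Subset n} {r′ : ℕ} →
              IsKGraph k G → SubgraphOf F G → Heavy (r′ * k) F S →
              {M : Vector (Subset n) (suc r′)} → IsMatching (AddEdgesContaining G S F) M →
              (a : Fin (suc r′)) → ∃ λ e → F e × ∀ j → j ≢ a → Apart e (M j)
swap-into-F {G = G} G-kgraph F⊆G S-heavy {M} (M∈F′ , M-pw) a with M∈F′ a
... | inj₁ F[Ma]      = _ , F[Ma] , λ j j≢a → M-pw a j (j≢a ∘ sym)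
... | inj₂ (_ , S⊆Ma) = swap-edge-containing G-kgraph S-heavy (M∈G , M-pw) a S⊆Ma
  where
  M∈G : ∀ i → G (M i)
  M∈G i = [ F⊆G (M i) , proj₁ ]′ (M∈F′ i)

module _ {F H : Hypergraph n} (F⊆H : SubgraphOf F H)
         (swap : {M : Vector (Subset n) m} → IsMatching H M →
                 (a : Fin m) → ∃ λ e → F e × ∀ j → j ≢ a → Apart e (M j))
  where

  swap-all : (is : List (Fin m)) {M : Vector (Subset n) m} → IsMatching H M →
             ∃ λ M′ → IsMatching H M′ × (∀ {i} → i ∈ₗ is → F (M′ i))
  swap-all []       M-matching = _ , M-matching , λ ()
  swap-all (a ∷ is) M-matching =
    let M₁ , (M₁∈H , M₁-pw) , F[M₁] = swap-all is M-matching
        e , Fe , e-apart = swap (M₁∈H , M₁-pw) a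
    in  updateAt M₁ a (const e)
      , ( (λ i → updateAt-elim H M₁ a i (λ _ → F⊆H e Fe) (λ _ → M₁∈H i))
        , Pairwise-updateAt {R = Apart} Apart-sym M₁-pw e-apart )
      , λ {i} i∈a∷is → updateAt-elim F M₁ a i (λ _ → Fe) (λ i≢a → F[M₁] (Any.tail i≢a i∈a∷is))

  matching-in-subgraph : Matching H m → Matching F m
  matching-in-subgraph (M , M-matching) =
    let M′ , (_ , M′-pw) , F[M′] = swap-all (allFin m) M-matching
    in  M′ , (λ i → F[M′] (∈-allFin i)) , M′-pw

lemma4p1 : ∀ {n : ℕ} (k r : ℕ) → 1 ≤ r →
    (G F : Hypergraph n) → IsKGraph k G → SubgraphOf F G →
    νLess F r →
    (S : Subset n) → Heavy ((r ∸ 1) * k) F S →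
    νLess (AddEdgesContaining G S F) r
lemma4p1 k (suc r′) _ G F G-kgraph F⊆G ν[F]<r S S-heavy =
  ν[F]<r ∘ matching-in-subgraph {H = AddEdgesContaining G S F} (λ _ → inj₁)
                                (swap-into-F G-kgraph F⊆G S-heavy)
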